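{- Let $m$ be a positive integer with $4\mid m$. Then there exist two distinct sets $A, B\subseteq \mathbb{Z}_{m}$ with $A\cup B=\mathbb{Z}_{m}$, $B\neq A+\overline{\frac{m}{2}}$, and $|A\cap B|=4$ or $|A\cap B|=m-4$, such that $R_{A}(\overline{n})=R_{B}(\overline{n})$ for all $\overline{n}\in \mathbb{Z}_{m}$.
   Context: $\mathbb{Z}_m$ denotes the set (group) of residue classes modulo $m$. For $A\subseteq\mathbb{Z}_m$ and $\overline{n}\in\mathbb{Z}_m$, $R_A(\overline{n})$ is the number of ordered pairs $(\overline{a},\overline{a'})\in A\times A$ with $\overline{a}+\overline{a'}=\overline{n}$. For $\overline{c}\in\mathbb{Z}_m$, $A+\overline{c}=\{\overline{a}+\overline{c}:\overline{a}\in A\}$. -}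

module Defs where

open import Data.Nat using (ℕ; NonZero)
import Data.Nat as ℕ
open import Data.Nat.DivMod using (_mod_)
open import Data.Fin using (Fin; toℕ)
open import Data.Fin.Subset using (Subset; _∈_)
open import Data.Fin.Subset.Properties using (_∈?_)
open import Data.List using (length; filter; cartesianProduct; allFin)
open import Data.Product using (_×_; _,_)
open import Data.Vec using (tabulate; lookup)
open import Relation.Nullary using (Dec; _×-dec_)
open import Data.Fin.Properties using (_≟_)
open import Relation.Binary.PropositionalEquality using (_≡_)

-- ℤ_m is modelled as Fin m (residues 0,…,m-1); addition of residue classes.
infixl 6 _⊕_
_⊕_ : ∀ {m} .{{_ : NonZero m}} → Fin m → Fin m → Fin m
_⊕_ {m} a b = (toℕ a ℕ.+ toℕ b) mod m

⊖_ : ∀ {m} .{{_ : NonZero m}} → Fin m → Fin m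
⊖_ {m} a = (m ℕ.∸ toℕ a) mod m

-- Translate A + c = { a + c : a ∈ A }.  Since a ↦ a + c is a bijection of ℤ_m,
-- x ∈ A + c  iff  x - c ∈ A; we build the subset by this membership rule.
_+ₛ_ : ∀ {m} .{{_ : NonZero m}} → Subset m → Fin m → Subset m
A +ₛ c = tabulate (λ x → lookup A (x ⊕ (⊖ c)))

Rep : ∀ {m} .{{_ : NonZero m}} → Subset m → Fin m → Fin m × Fin m → Set
Rep A n (a , a') = (a ∈ A) × (a' ∈ A) × (a ⊕ a' ≡ n)

rep? : ∀ {m} .{{_ : NonZero m}} (A : Subset m) (n : Fin m) (p : Fin m × Fin m) → Dec (Rep A n p)
rep? A n (a , a') = (a ∈? A) ×-dec ((a' ∈? A) ×-dec ((a ⊕ a') ≟ n))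

R : ∀ {m} .{{_ : NonZero m}} → Subset m → Fin m → ℕ
R {m} A n = length (filter (rep? A n) (cartesianProduct (allFin m) (allFin m)))

module Submission where

-- Write m = 4q and put  S = {0, 2q},  T = {q, 3q},  A = ℤ_m ∖ S,  B = ℤ_m ∖ T.
-- Then B = A + q and, because S is invariant under translation by 2q, also
-- B = A + 3q = A - q.  Hence (a, a') ↦ (a + q, a' - q) maps the pairs of A × A
-- with sum n bijectively onto the pairs of B × B with sum n, so R_A = R_B.
-- The four elements 0, q, 2q, 3q are distinct, so A ∪ B = ℤ_m,
-- |A ∩ B| = m - 4 and A ≠ B; finally 0 ∈ B while 0 ∉ A + m/2 = A + 2q.

open import Defs
open import Data.Nat using (ℕ; NonZero; _/_; _∸_)
open import Data.Nat.DivMod using (_mod_)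
open import Data.Nat.Divisibility using (_∣_)
open import Data.Fin using (Fin)
open import Data.Fin.Subset using (Subset; _∪_; _∩_; ∣_∣; ⊤)
open import Data.Product using (Σ; _×_)
open import Data.Sum using (_⊎_)
open import Relation.Binary.PropositionalEquality using (_≡_; _≢_)

open import Level using (Level)
open import Data.Nat using (suc; _+_; _*_; _%_; _<_)
import Data.Nat.Properties as ℕₚ
open import Data.Nat.DivMod
  using (%-distribˡ-+; m%n%n≡m%n; [m+n]%n≡m%n; m<n⇒m%n≡m; m%n*o≡m*o%[n*o]; %-congʳ; m*n/n≡m)
open import Data.Nat.Divisibility using (divides)
open import Data.Fin using (toℕ; fromℕ<; #_)
open import Data.Fin.Properties using (toℕ-fromℕ<; toℕ-injective; toℕ<n)
open import Data.Fin.Subset using (_∈_; _∉_; ⁅_⁆; ∁; ⊥; outside; inside)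
open import Data.Fin.Subset.Properties
  using ( x∈p∪q⁻; x∈p∪q⁺; x∈p∩q⁻; x∈⁅x⁆; x∈⁅y⁆⇒x≡y; ∣⁅x⁆∣≡1; ∣⊥∣≡0; Empty-unique
        ; x∈∁p⇒x∉p; x∉p⇒x∈∁p; ∣∁p∣≡n∸∣p∣; ∪-comm; ∪-∩-booleanAlgebra)
import Algebra.Lattice.Properties.BooleanAlgebra as BooleanAlgebraProperties
import Data.Vec as Vec
open import Data.Vec using (lookup; tabulate)
open import Data.Vec.Properties using (lookup∘tabulate; []=⇒lookup; lookup⇒[]=)
import Data.List as List
open import Data.List using (List; filter; length; map; cartesianProduct; allFin)
open import Data.List.Membership.Propositional using () renaming (_∈_ to _∈ₗ_)
open import Data.List.Membership.Propositional.Properties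
  using (∈-cartesianProduct⁺; ∈-allFin; ∈-map⁺)
open import Data.List.Membership.Propositional.Properties.WithK using (unique∧set⇒bag)
open import Data.List.Relation.Unary.Unique.Propositional using (Unique)
import Data.List.Relation.Unary.Unique.Propositional.Properties as Uniqueₚ
open import Data.List.Relation.Binary.BagAndSetEquality using (∼bag⇒↭)
open import Data.List.Relation.Binary.Permutation.Propositional using (_↭_)
open import Data.List.Relation.Binary.Permutation.Propositional.Properties
  using (↭-length; filter-↭)
open import Data.Product using (_,_)
open import Data.Sum using (inj₁; inj₂) renaming (map to ⊎-map)
open import Data.Empty using (⊥-elim)
open import Relation.Nullary using (yes; no)
open import Relation.Unary using (Pred; Decidable)
open import Function using (_⇔_; mk⇔; Equivalence)
open import Relation.Binary.PropositionalEquality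
  using (refl; sym; trans; cong; cong₂; subst; subst₂; module ≡-Reasoning)

module Residues {m : ℕ} .{{_ : NonZero m}} where

  toℕ-⊕ : (a b : Fin m) → toℕ (a ⊕ b) ≡ (toℕ a + toℕ b) % m
  toℕ-⊕ a b = toℕ-fromℕ< _

  toℕ-⊖ : (a : Fin m) → toℕ (⊖ a) ≡ (m ∸ toℕ a) % m
  toℕ-⊖ a = toℕ-fromℕ< _

  %-absorbˡ : (x y : ℕ) → (x % m + y) % m ≡ (x + y) % m
  %-absorbˡ x y = begin
    (x % m + y) % m           ≡⟨ %-distribˡ-+ (x % m) y m ⟩
    (x % m % m + y % m) % m   ≡⟨ cong (λ z → (z + y % m) % m) (m%n%n≡m%n x m) ⟩
    (x % m + y % m) % m       ≡⟨ sym (%-distribˡ-+ x y m) ⟩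
    (x + y) % m               ∎
    where open ≡-Reasoning

  %-absorbʳ : (x y : ℕ) → (x + y % m) % m ≡ (x + y) % m
  %-absorbʳ x y = begin
    (x + y % m) % m  ≡⟨ cong (_% m) (ℕₚ.+-comm x (y % m)) ⟩
    (y % m + x) % m  ≡⟨ %-absorbˡ y x ⟩
    (y + x) % m      ≡⟨ cong (_% m) (ℕₚ.+-comm y x) ⟩
    (x + y) % m      ∎
    where open ≡-Reasoning

  ⊕-comm : (a b : Fin m) → a ⊕ b ≡ b ⊕ a
  ⊕-comm a b = toℕ-injective (begin
    toℕ (a ⊕ b)              ≡⟨ toℕ-⊕ a b ⟩
    (toℕ a + toℕ b) % m      ≡⟨ cong (_% m) (ℕₚ.+-comm (toℕ a) (toℕ b)) ⟩
    (toℕ b + toℕ a) % m      ≡⟨ sym (toℕ-⊕ b a) ⟩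
    toℕ (b ⊕ a)              ∎)
    where open ≡-Reasoning

  ⊕-assoc : (a b c : Fin m) → (a ⊕ b) ⊕ c ≡ a ⊕ (b ⊕ c)
  ⊕-assoc a b c = toℕ-injective (begin
    toℕ ((a ⊕ b) ⊕ c)                   ≡⟨ toℕ-⊕ (a ⊕ b) c ⟩
    (toℕ (a ⊕ b) + toℕ c) % m           ≡⟨ cong (λ z → (z + toℕ c) % m) (toℕ-⊕ a b) ⟩
    ((toℕ a + toℕ b) % m + toℕ c) % m   ≡⟨ %-absorbˡ (toℕ a + toℕ b) (toℕ c) ⟩
    (toℕ a + toℕ b + toℕ c) % m         ≡⟨ cong (_% m) (ℕₚ.+-assoc (toℕ a) (toℕ b) (toℕ c)) ⟩
    (toℕ a + (toℕ b + toℕ c)) % m       ≡⟨ sym (%-absorbʳ (toℕ a) (toℕ b + toℕ c)) ⟩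
    (toℕ a + (toℕ b + toℕ c) % m) % m   ≡⟨ cong (λ z → (toℕ a + z) % m) (sym (toℕ-⊕ b c)) ⟩
    (toℕ a + toℕ (b ⊕ c)) % m           ≡⟨ sym (toℕ-⊕ a (b ⊕ c)) ⟩
    toℕ (a ⊕ (b ⊕ c))                   ∎)
    where open ≡-Reasoning

  ⊕-⊖-cancel : (a c : Fin m) → (a ⊕ c) ⊕ ⊖ c ≡ a
  ⊕-⊖-cancel a c = toℕ-injective (begin
    toℕ ((a ⊕ c) ⊕ ⊖ c)                           ≡⟨ toℕ-⊕ (a ⊕ c) (⊖ c) ⟩
    (toℕ (a ⊕ c) + toℕ (⊖ c)) % m                 ≡⟨ cong₂ (λ x y → (x + y) % m) (toℕ-⊕ a c) (toℕ-⊖ c) ⟩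
    ((toℕ a + toℕ c) % m + (m ∸ toℕ c) % m) % m   ≡⟨ %-absorbˡ (toℕ a + toℕ c) _ ⟩
    (toℕ a + toℕ c + (m ∸ toℕ c) % m) % m         ≡⟨ %-absorbʳ (toℕ a + toℕ c) (m ∸ toℕ c) ⟩
    (toℕ a + toℕ c + (m ∸ toℕ c)) % m             ≡⟨ cong (_% m) (ℕₚ.+-assoc (toℕ a) (toℕ c) _) ⟩
    (toℕ a + (toℕ c + (m ∸ toℕ c))) % m           ≡⟨ cong (λ z → (toℕ a + z) % m) (ℕₚ.m+[n∸m]≡n (ℕₚ.<⇒≤ (toℕ<n c))) ⟩
    (toℕ a + m) % m                               ≡⟨ [m+n]%n≡m%n (toℕ a) m ⟩
    toℕ a % m                                     ≡⟨ m<n⇒m%n≡m (toℕ<n a) ⟩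
    toℕ a                                         ∎)
    where open ≡-Reasoning

  ⊕-swapʳ : (a b c : Fin m) → (a ⊕ b) ⊕ c ≡ (a ⊕ c) ⊕ b
  ⊕-swapʳ a b c = begin
    (a ⊕ b) ⊕ c   ≡⟨ ⊕-assoc a b c ⟩
    a ⊕ (b ⊕ c)   ≡⟨ cong (a ⊕_) (⊕-comm b c) ⟩
    a ⊕ (c ⊕ b)   ≡⟨ sym (⊕-assoc a c b) ⟩
    (a ⊕ c) ⊕ b   ∎
    where open ≡-Reasoning

  ⊖-⊕-cancel : (a c : Fin m) → (a ⊕ ⊖ c) ⊕ c ≡ a
  ⊖-⊕-cancel a c = trans (⊕-swapʳ a (⊖ c) c) (⊕-⊖-cancel a c)

  ⊕-cancelʳ : {a b : Fin m} (c : Fin m) → a ⊕ c ≡ b ⊕ c → a ≡ b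
  ⊕-cancelʳ {a} {b} c e = begin
    a                ≡⟨ sym (⊕-⊖-cancel a c) ⟩
    (a ⊕ c) ⊕ ⊖ c    ≡⟨ cong (_⊕ ⊖ c) e ⟩
    (b ⊕ c) ⊕ ⊖ c    ≡⟨ ⊕-⊖-cancel b c ⟩
    b                ∎
    where open ≡-Reasoning

  ⊕-transfer : (a b c : Fin m) → (a ⊕ c) ⊕ (b ⊕ ⊖ c) ≡ a ⊕ b
  ⊕-transfer a b c = begin
    (a ⊕ c) ⊕ (b ⊕ ⊖ c)   ≡⟨ sym (⊕-assoc (a ⊕ c) b (⊖ c)) ⟩
    ((a ⊕ c) ⊕ b) ⊕ ⊖ c   ≡⟨ cong (_⊕ ⊖ c) (⊕-swapʳ a c b) ⟩
    ((a ⊕ b) ⊕ c) ⊕ ⊖ c   ≡⟨ ⊕-⊖-cancel (a ⊕ b) c ⟩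
    a ⊕ b                 ∎
    where open ≡-Reasoning

open Residues

∣p∪q∣+∣p∩q∣ : {n : ℕ} (p q : Subset n) → ∣ p ∪ q ∣ + ∣ p ∩ q ∣ ≡ ∣ p ∣ + ∣ q ∣
∣p∪q∣+∣p∩q∣ Vec.[] Vec.[] = refl
∣p∪q∣+∣p∩q∣ (outside Vec.∷ p) (outside Vec.∷ q) = ∣p∪q∣+∣p∩q∣ p q
∣p∪q∣+∣p∩q∣ (outside Vec.∷ p) (inside Vec.∷ q) =
  trans (cong suc (∣p∪q∣+∣p∩q∣ p q)) (sym (ℕₚ.+-suc ∣ p ∣ ∣ q ∣))
∣p∪q∣+∣p∩q∣ (inside Vec.∷ p) (outside Vec.∷ q) = cong suc (∣p∪q∣+∣p∩q∣ p q)
∣p∪q∣+∣p∩q∣ (inside Vec.∷ p) (inside Vec.∷ q) =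
  cong suc (trans (ℕₚ.+-suc ∣ p ∪ q ∣ ∣ p ∩ q ∣)
                  (trans (cong suc (∣p∪q∣+∣p∩q∣ p q)) (sym (ℕₚ.+-suc ∣ p ∣ ∣ q ∣))))

Disjoint : {n : ℕ} → Subset n → Subset n → Set
Disjoint p q = ∀ x → x ∈ p → x ∉ q

disjoint⇒∩≡⊥ : {n : ℕ} {p q : Subset n} → Disjoint p q → p ∩ q ≡ ⊥
disjoint⇒∩≡⊥ {p = p} {q} p#q = Empty-unique (λ (x , x∈p∩q) →
  let (x∈p , x∈q) = x∈p∩q⁻ p q x∈p∩q in p#q x x∈p x∈q)

∣disjoint-∪∣ : {n : ℕ} {p q : Subset n} → Disjoint p q → ∣ p ∪ q ∣ ≡ ∣ p ∣ + ∣ q ∣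
∣disjoint-∪∣ {n} {p} {q} p#q = begin
  ∣ p ∪ q ∣               ≡⟨ sym (ℕₚ.+-identityʳ ∣ p ∪ q ∣) ⟩
  ∣ p ∪ q ∣ + 0           ≡⟨ cong (∣ p ∪ q ∣ +_) (sym (∣⊥∣≡0 n)) ⟩
  ∣ p ∪ q ∣ + ∣ ⊥ {n} ∣   ≡⟨ cong (λ r → ∣ p ∪ q ∣ + ∣ r ∣) (sym (disjoint⇒∩≡⊥ p#q)) ⟩
  ∣ p ∪ q ∣ + ∣ p ∩ q ∣   ≡⟨ ∣p∪q∣+∣p∩q∣ p q ⟩
  ∣ p ∣ + ∣ q ∣           ∎
  where open ≡-Reasoning

pair : {n : ℕ} → Fin n → Fin n → Subset n
pair u v = ⁅ u ⁆ ∪ ⁅ v ⁆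

∈-pair⁻ : {n : ℕ} {u v x : Fin n} → x ∈ pair u v → x ≡ u ⊎ x ≡ v
∈-pair⁻ {u = u} {v} x∈uv with x∈p∪q⁻ ⁅ u ⁆ ⁅ v ⁆ x∈uv
... | inj₁ x∈u = inj₁ (x∈⁅y⁆⇒x≡y u x∈u)
... | inj₂ x∈v = inj₂ (x∈⁅y⁆⇒x≡y v x∈v)

∈-pair⁺ : {n : ℕ} {u v x : Fin n} → x ≡ u ⊎ x ≡ v → x ∈ pair u v
∈-pair⁺ (inj₁ refl) = x∈p∪q⁺ (inj₁ (x∈⁅x⁆ _))
∈-pair⁺ (inj₂ refl) = x∈p∪q⁺ (inj₂ (x∈⁅x⁆ _))

pair-comm : {n : ℕ} (u v : Fin n) → pair u v ≡ pair v u
pair-comm u v = ∪-comm ⁅ u ⁆ ⁅ v ⁆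

pairs-disjoint : {n : ℕ} {u v u' v' : Fin n} →
                 u ≢ u' → u ≢ v' → v ≢ u' → v ≢ v' → Disjoint (pair u v) (pair u' v')
pairs-disjoint u≢u' u≢v' v≢u' v≢v' x x∈uv x∈u'v' with ∈-pair⁻ x∈uv | ∈-pair⁻ x∈u'v'
... | inj₁ refl | inj₁ e = u≢u' e
... | inj₁ refl | inj₂ e = u≢v' e
... | inj₂ refl | inj₁ e = v≢u' e
... | inj₂ refl | inj₂ e = v≢v' e

∣pair∣ : {n : ℕ} {u v : Fin n} → u ≢ v → ∣ pair u v ∣ ≡ 2
∣pair∣ {u = u} {v} u≢v = begin
  ∣ ⁅ u ⁆ ∪ ⁅ v ⁆ ∣       ≡⟨ ∣disjoint-∪∣ singletons-disjoint ⟩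
  ∣ ⁅ u ⁆ ∣ + ∣ ⁅ v ⁆ ∣   ≡⟨ cong₂ _+_ (∣⁅x⁆∣≡1 u) (∣⁅x⁆∣≡1 v) ⟩
  2                       ∎
  where
  open ≡-Reasoning
  singletons-disjoint : Disjoint ⁅ u ⁆ ⁅ v ⁆
  singletons-disjoint x x∈u x∈v = u≢v (trans (sym (x∈⁅y⁆⇒x≡y u x∈u)) (x∈⁅y⁆⇒x≡y v x∈v))

module Translates {m : ℕ} .{{_ : NonZero m}} where

  IsTranslate : Subset m → Fin m → Subset m → Set
  IsTranslate A c B = (a : Fin m) → a ∈ A ⇔ a ⊕ c ∈ B

  ∁-translate : {S T : Subset m} {c : Fin m} → IsTranslate S c T → IsTranslate (∁ S) c (∁ T)
  ∁-translate S→T a = mk⇔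
    (λ a∈∁S → x∉p⇒x∈∁p (λ a+c∈T → x∈∁p⇒x∉p a∈∁S (Equivalence.from (S→T a) a+c∈T)))
    (λ a+c∈∁T → x∉p⇒x∈∁p (λ a∈S → x∈∁p⇒x∉p a+c∈∁T (Equivalence.to (S→T a) a∈S)))

  ∈-+ₛ⁻ : (A : Subset m) (c : Fin m) {x : Fin m} → x ∈ A +ₛ c → x ⊕ ⊖ c ∈ A
  ∈-+ₛ⁻ A c {x} x∈A+c = lookup⇒[]= (x ⊕ ⊖ c) A (begin
    lookup A (x ⊕ ⊖ c)                                   ≡⟨ sym (lookup∘tabulate (λ y → lookup A (y ⊕ ⊖ c)) x) ⟩
    lookup (tabulate (λ y → lookup A (y ⊕ ⊖ c))) x       ≡⟨ []=⇒lookup x∈A+c ⟩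
    inside                                               ∎)
    where open ≡-Reasoning

  translate-pair : (u v c : Fin m) → IsTranslate (pair u v) c (pair (u ⊕ c) (v ⊕ c))
  translate-pair u v c a = mk⇔
    (λ a∈uv → ∈-pair⁺ (⊎-map (cong (_⊕ c)) (cong (_⊕ c)) (∈-pair⁻ a∈uv)))
    (λ a+c∈uv → ∈-pair⁺ (⊎-map (⊕-cancelʳ c) (⊕-cancelʳ c) (∈-pair⁻ a+c∈uv)))

open Translates

-- Counting principle.  Filtering a duplicate-free list containing every element
-- of X counts the elements of a predicate; a bijection of X carrying P onto Q
-- therefore preserves these counts.

module Counting {X : Set} where

  filter-map : {ℓ : Level} (σ : X → X) {P Q : Pred X ℓ} (P? : Decidable P) (Q? : Decidable Q) →
               ((x : X) → P x ⇔ Q (σ x)) →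
               (xs : List X) → length (filter P? xs) ≡ length (filter Q? (map σ xs))
  filter-map σ P? Q? P⇔Qσ List.[] = refl
  filter-map σ P? Q? P⇔Qσ (x List.∷ xs) with P? x | Q? (σ x)
  ... | yes _  | yes _  = cong suc (filter-map σ P? Q? P⇔Qσ xs)
  ... | yes p  | no ¬q  = ⊥-elim (¬q (Equivalence.to (P⇔Qσ x) p))
  ... | no ¬p  | yes q  = ⊥-elim (¬p (Equivalence.from (P⇔Qσ x) q))
  ... | no _   | no _   = filter-map σ P? Q? P⇔Qσ xs

  map-bijection-↭ : (σ τ : X → X) → ((x : X) → τ (σ x) ≡ x) → ((x : X) → σ (τ x) ≡ x) →
                    {xs : List X} → Unique xs → ((x : X) → x ∈ₗ xs) → map σ xs ↭ xs
  map-bijection-↭ σ τ τσ στ {xs} unique complete =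
    ∼bag⇒↭ (unique∧set⇒bag (Uniqueₚ.map⁺ σ-injective unique) unique
      (λ {x} → mk⇔ (λ _ → complete x)
                   (λ _ → subst (_∈ₗ map σ xs) (στ x) (∈-map⁺ σ (complete (τ x))))))
    where
    σ-injective : {x y : X} → σ x ≡ σ y → x ≡ y
    σ-injective {x} {y} e = trans (sym (τσ x)) (trans (cong τ e) (τσ y))

  count-bijection : {ℓ : Level} (σ τ : X → X) → ((x : X) → τ (σ x) ≡ x) → ((x : X) → σ (τ x) ≡ x) →
                    {P Q : Pred X ℓ} (P? : Decidable P) (Q? : Decidable Q) →
                    ((x : X) → P x ⇔ Q (σ x)) →
                    {xs : List X} → Unique xs → ((x : X) → x ∈ₗ xs) →
                    length (filter P? xs) ≡ length (filter Q? xs)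
  count-bijection σ τ τσ στ P? Q? P⇔Qσ {xs} unique complete = begin
    length (filter P? xs)            ≡⟨ filter-map σ P? Q? P⇔Qσ xs ⟩
    length (filter Q? (map σ xs))    ≡⟨ ↭-length (filter-↭ Q? (map-bijection-↭ σ τ τσ στ unique complete)) ⟩
    length (filter Q? xs)            ∎
    where open ≡-Reasoning

open Counting

R-translate : {m : ℕ} .{{_ : NonZero m}} (A B : Subset m) (c : Fin m) →
              IsTranslate A c B → IsTranslate A (⊖ c) B → (n : Fin m) → R A n ≡ R B n
R-translate {m} A B c A+c A-c n =
  count-bijection σ τ τσ στ (rep? A n) (rep? B n) Rep-transfer
    (Uniqueₚ.cartesianProduct⁺ (Uniqueₚ.allFin⁺ m) (Uniqueₚ.allFin⁺ m))
    (λ (a , a') → ∈-cartesianProduct⁺ (∈-allFin a) (∈-allFin a'))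
  where
  σ τ : Fin m × Fin m → Fin m × Fin m
  σ (a , a') = a ⊕ c , a' ⊕ ⊖ c
  τ (a , a') = a ⊕ ⊖ c , a' ⊕ c

  τσ : (p : Fin m × Fin m) → τ (σ p) ≡ p
  τσ (a , a') = cong₂ _,_ (⊕-⊖-cancel a c) (⊖-⊕-cancel a' c)

  στ : (p : Fin m × Fin m) → σ (τ p) ≡ p
  στ (a , a') = cong₂ _,_ (⊖-⊕-cancel a c) (⊕-⊖-cancel a' c)

  Rep-transfer : (p : Fin m × Fin m) → Rep A n p ⇔ Rep B n (σ p)
  Rep-transfer (a , a') = mk⇔
    (λ (a∈A , a'∈A , sum) → Equivalence.to (A+c a) a∈A , Equivalence.to (A-c a') a'∈A ,
                             trans (⊕-transfer a a' c) sum)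
    (λ (a∈B , a'∈B , sum) → Equivalence.from (A+c a) a∈B , Equivalence.from (A-c a') a'∈B ,
                             trans (sym (⊕-transfer a a' c)) sum)

module Multiples (n q : ℕ) .{{_ : NonZero n}} .{{_ : NonZero q}} where

  private instance
    qn≢0 : NonZero (q * n)
    qn≢0 = ℕₚ.m*n≢0 q n
    nq≢0 : NonZero (n * q)
    nq≢0 = ℕₚ.m*n≢0 n q

  ι : Fin n → Fin (q * n)
  ι k = fromℕ< (subst (toℕ k * q <_) (ℕₚ.*-comm n q) (ℕₚ.*-monoˡ-< q (toℕ<n k)))

  toℕ-ι : (k : Fin n) → toℕ (ι k) ≡ toℕ k * q
  toℕ-ι k = toℕ-fromℕ< _

  %-scale : (x : ℕ) → (x * q) % (q * n) ≡ (x % n) * q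
  %-scale x = sym (trans (m%n*o≡m*o%[n*o] x n q) (%-congʳ (ℕₚ.*-comm n q)))

  ι-⊕ : (i j : Fin n) → ι i ⊕ ι j ≡ ι (i ⊕ j)
  ι-⊕ i j = toℕ-injective (begin
    toℕ (ι i ⊕ ι j)                        ≡⟨ toℕ-⊕ (ι i) (ι j) ⟩
    (toℕ (ι i) + toℕ (ι j)) % (q * n)      ≡⟨ cong₂ (λ x y → (x + y) % (q * n)) (toℕ-ι i) (toℕ-ι j) ⟩
    (toℕ i * q + toℕ j * q) % (q * n)      ≡⟨ cong (_% (q * n)) (sym (ℕₚ.*-distribʳ-+ q (toℕ i) (toℕ j))) ⟩
    ((toℕ i + toℕ j) * q) % (q * n)        ≡⟨ %-scale (toℕ i + toℕ j) ⟩
    ((toℕ i + toℕ j) % n) * q              ≡⟨ cong (_* q) (sym (toℕ-⊕ i j)) ⟩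
    toℕ (i ⊕ j) * q                        ≡⟨ sym (toℕ-ι (i ⊕ j)) ⟩
    toℕ (ι (i ⊕ j))                        ∎)
    where open ≡-Reasoning

  ι-⊖ : (j : Fin n) → ⊖ ι j ≡ ι (⊖ j)
  ι-⊖ j = toℕ-injective (begin
    toℕ (⊖ ι j)                        ≡⟨ toℕ-⊖ (ι j) ⟩
    (q * n ∸ toℕ (ι j)) % (q * n)      ≡⟨ cong₂ (λ x y → (x ∸ y) % (q * n)) (ℕₚ.*-comm q n) (toℕ-ι j) ⟩
    (n * q ∸ toℕ j * q) % (q * n)      ≡⟨ cong (_% (q * n)) (sym (ℕₚ.*-distribʳ-∸ q n (toℕ j))) ⟩
    ((n ∸ toℕ j) * q) % (q * n)        ≡⟨ %-scale (n ∸ toℕ j) ⟩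
    ((n ∸ toℕ j) % n) * q              ≡⟨ cong (_* q) (sym (toℕ-⊖ j)) ⟩
    toℕ (⊖ j) * q                      ≡⟨ sym (toℕ-ι (⊖ j)) ⟩
    toℕ (ι (⊖ j))                      ∎)
    where open ≡-Reasoning

  ι-injective : {i j : Fin n} → ι i ≡ ι j → i ≡ j
  ι-injective {i} {j} e = toℕ-injective
    (ℕₚ.*-cancelʳ-≡ (toℕ i) (toℕ j) q (trans (sym (toℕ-ι i)) (trans (cong toℕ e) (toℕ-ι j))))

module Construction (q : ℕ) .{{_ : NonZero q}} where

  open Multiples 4 q

  m : ℕ
  m = q * 4

  instance
    m≢0 : NonZero m
    m≢0 = ℕₚ.m*n≢0 q 4

  S T A B : Subset m
  S = pair (ι (# 0)) (ι (# 2))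
  T = pair (ι (# 1)) (ι (# 3))
  A = ∁ S
  B = ∁ T

  ι-distinct : (i j : Fin 4) → i ≢ j → ι i ≢ ι j
  ι-distinct i j i≢j e = i≢j (ι-injective e)

  S#T : Disjoint S T
  S#T = pairs-disjoint (ι-distinct (# 0) (# 1) (λ ())) (ι-distinct (# 0) (# 3) (λ ()))
                       (ι-distinct (# 2) (# 1) (λ ())) (ι-distinct (# 2) (# 3) (λ ()))

  0∈S : ι (# 0) ∈ S
  0∈S = ∈-pair⁺ (inj₁ refl)

  0∈B : ι (# 0) ∈ B
  0∈B = x∉p⇒x∈∁p (S#T (ι (# 0)) 0∈S)

  S+q : IsTranslate S (ι (# 1)) T
  S+q = subst (IsTranslate S (ι (# 1)))
              (cong₂ pair (ι-⊕ (# 0) (# 1)) (ι-⊕ (# 2) (# 1)))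
              (translate-pair (ι (# 0)) (ι (# 2)) (ι (# 1)))

  S-q : IsTranslate S (⊖ ι (# 1)) T
  S-q = subst₂ (IsTranslate S) (sym (ι-⊖ (# 1)))
               (trans (cong₂ pair (ι-⊕ (# 0) (# 3)) (ι-⊕ (# 2) (# 3))) (pair-comm (ι (# 3)) (ι (# 1))))
               (translate-pair (ι (# 0)) (ι (# 2)) (ι (# 3)))

  R-equal : (n : Fin m) → R A n ≡ R B n
  R-equal = R-translate A B (ι (# 1)) (∁-translate S+q) (∁-translate S-q)

  A≢B : A ≢ B
  A≢B A≡B = x∈∁p⇒x∉p (subst (ι (# 0) ∈_) (sym A≡B) 0∈B) 0∈S

  A∪B≡⊤ : A ∪ B ≡ ⊤
  A∪B≡⊤ = begin
    ∁ S ∪ ∁ T   ≡⟨ sym (deMorgan₁ S T) ⟩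
    ∁ (S ∩ T)   ≡⟨ cong ∁ (disjoint⇒∩≡⊥ S#T) ⟩
    ∁ ⊥         ≡⟨ ¬⊥≈⊤ ⟩
    ⊤           ∎
    where open ≡-Reasoning
          open BooleanAlgebraProperties (∪-∩-booleanAlgebra m) using (deMorgan₁; ¬⊥≈⊤)

  ∣A∩B∣ : ∣ A ∩ B ∣ ≡ m ∸ 4
  ∣A∩B∣ = begin
    ∣ ∁ S ∩ ∁ T ∣     ≡⟨ cong ∣_∣ (sym (deMorgan₂ S T)) ⟩
    ∣ ∁ (S ∪ T) ∣     ≡⟨ ∣∁p∣≡n∸∣p∣ (S ∪ T) ⟩
    m ∸ ∣ S ∪ T ∣     ≡⟨ cong (m ∸_) (∣disjoint-∪∣ S#T) ⟩
    m ∸ (∣ S ∣ + ∣ T ∣) ≡⟨ cong₂ (λ s t → m ∸ (s + t)) (∣pair∣ (ι-distinct (# 0) (# 2) (λ ())))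
                                                      (∣pair∣ (ι-distinct (# 1) (# 3) (λ ()))) ⟩
    m ∸ 4             ∎
    where open ≡-Reasoning
          open BooleanAlgebraProperties (∪-∩-booleanAlgebra m) using (deMorgan₂)

  half≡2q : (m / 2) mod m ≡ ι (# 2)
  half≡2q = toℕ-injective (begin
    toℕ ((m / 2) mod m)   ≡⟨ toℕ-fromℕ< _ ⟩
    (m / 2) % m           ≡⟨ cong (λ x → (x / 2) % m) (sym (ℕₚ.*-assoc q 2 2)) ⟩
    (q * 2 * 2 / 2) % m   ≡⟨ cong (_% m) (trans (m*n/n≡m (q * 2) 2) (ℕₚ.*-comm q 2)) ⟩
    (2 * q) % m           ≡⟨ cong (_% m) (sym (toℕ-ι (# 2))) ⟩
    toℕ (ι (# 2)) % m     ≡⟨ m<n⇒m%n≡m (toℕ<n (ι (# 2))) ⟩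
    toℕ (ι (# 2))         ∎)
    where open ≡-Reasoning

  B≢A+half : B ≢ A +ₛ ((m / 2) mod m)
  B≢A+half B≡A+half = x∈∁p⇒x∉p 2q∈A (∈-pair⁺ (inj₂ refl))
    where
    0-2q≡2q : ι (# 0) ⊕ ⊖ ((m / 2) mod m) ≡ ι (# 2)
    0-2q≡2q = begin
      ι (# 0) ⊕ ⊖ ((m / 2) mod m)   ≡⟨ cong (λ c → ι (# 0) ⊕ ⊖ c) half≡2q ⟩
      ι (# 0) ⊕ ⊖ ι (# 2)           ≡⟨ cong (ι (# 0) ⊕_) (ι-⊖ (# 2)) ⟩
      ι (# 0) ⊕ ι (⊖ (# 2))         ≡⟨ ι-⊕ (# 0) (⊖ (# 2)) ⟩
      ι (# 2)                       ∎
      where open ≡-Reasoning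
    2q∈A : ι (# 2) ∈ A
    2q∈A = subst (_∈ A) 0-2q≡2q (∈-+ₛ⁻ A ((m / 2) mod m) (subst (ι (# 0) ∈_) B≡A+half 0∈B))

theorem1p2 : (m : ℕ) .{{_ : NonZero m}} → 4 ∣ m →
    Σ (Subset m) λ A → Σ (Subset m) λ B →
      (A ≢ B) × (A ∪ B ≡ ⊤) × (B ≢ A +ₛ ((m / 2) mod m)) ×
      ((∣ A ∩ B ∣ ≡ 4) ⊎ (∣ A ∩ B ∣ ≡ m ∸ 4)) ×
      ((n : Fin m) → R A n ≡ R B n)
theorem1p2 .(q * 4) (divides q refl) =
  A , B , A≢B , A∪B≡⊤ , B≢A+half , inj₂ ∣A∩B∣ , R-equal
  where open Construction q {{ℕₚ.m*n≢0⇒m≢0 q}}
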